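{- Let $X$ be a set. For every term $t\in T_\Sigma(X)$ there exists a term $t'\in T_\Sigma(X)$ in n-p form such that $t=_Et'$.
   Context: $\Sigma$ is the signature with a binary operation $\oplus$ and binary operations $+_p$ for each $p\in(0,1)$; $\Sigma_P\subseteq\Sigma$ consists of the $+_p$ only. $T_\Sigma(X)$, $T_{\Sigma_P}(X)$ are the term sets over variables $X$. $E$ is the set of axioms: $(x\oplus y)\oplus z=x\oplus(y\oplus z)$, $x\oplus y=y\oplus x$, $x\oplus x=x$, $(x+_qy)+_pz=x+_{pq}(y+_{\frac{p(1-q)}{1-pq}}z)$, $x+_py=y+_{1-p}x$, $x+_px=x$, $(x\oplus y)+_pz=(x+_pz)\oplus(y+_pz)$; $=_E$ is the congruence they generate. A term $t\in T_\Sigma(X)$ is in n-p form if $t=t_1\oplus\dots\oplus t_n$ for some $t_1,\dots,t_n\in T_{\Sigma_P}(X)$ (terms containing no $\oplus$). -}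

module Defs where

open import Data.List.NonEmpty using (List⁺; _∷_)
import Data.List.NonEmpty
open import Data.List using (List; []; _∷_)
open import Data.List.Relation.Unary.All using (All)
open import Data.Product using (Σ; _×_)
open import Relation.Binary.PropositionalEquality using (_≡_)

-- The set of probability labels p ∈ (0,1), abstracted (agda-stdlib has no
-- reals).  The axioms of E only use the operations
--   p,q ↦ p·q,   p ↦ 1-p,   p,q ↦ p(1-q)/(1-pq),
-- all of which are total on (0,1).
record ProbLabels : Set₁ where
  field
    Prob  : Set
    _·_   : Prob → Prob → Prob
    compl : Prob → Prob
    reass : Prob → Prob → Prob            -- p q ↦ p(1-q)/(1-pq)

module _ (L : ProbLabels) where
  open ProbLabels L

  data Term (X : Set) : Set where
    var   : X → Term X
    _⊕_   : Term X → Term X → Term X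
    _+[_]_ : Term X → Prob → Term X → Term X

  infixr 6 _⊕_
  infixr 7 _+[_]_

  data ⊕Free {X : Set} : Term X → Set where
    var  : (x : X) → ⊕Free (var x)
    prob : ∀ {s t} p → ⊕Free s → ⊕Free t → ⊕Free (s +[ p ] t)

  data _=E_ {X : Set} : Term X → Term X → Set where
    ⊕-assoc : ∀ x y z → ((x ⊕ y) ⊕ z) =E (x ⊕ (y ⊕ z))
    ⊕-comm  : ∀ x y → (x ⊕ y) =E (y ⊕ x)
    ⊕-idem  : ∀ x → (x ⊕ x) =E x
    +-assoc : ∀ x y z p q →
              ((x +[ q ] y) +[ p ] z) =E (x +[ p · q ] (y +[ reass p q ] z))
    +-comm  : ∀ x y p → (x +[ p ] y) =E (y +[ compl p ] x)
    +-idem  : ∀ x p → (x +[ p ] x) =E x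
    distr   : ∀ x y z p → ((x ⊕ y) +[ p ] z) =E ((x +[ p ] z) ⊕ (y +[ p ] z))
    refl    : ∀ {t} → t =E t
    sym     : ∀ {s t} → s =E t → t =E s
    trans   : ∀ {s t u} → s =E t → t =E u → s =E u
    cong-⊕  : ∀ {s s' t t'} → s =E s' → t =E t' → (s ⊕ t) =E (s' ⊕ t')
    cong-+  : ∀ {s s' t t'} p → s =E s' → t =E t' → (s +[ p ] t) =E (s' +[ p ] t')

  ⨁′ : {X : Set} → Term X → List (Term X) → Term X
  ⨁′ t []       = t
  ⨁′ t (u ∷ us) = t ⊕ ⨁′ u us

  ⨁ : {X : Set} → List⁺ (Term X) → Term X
  ⨁ (t ∷ ts) = ⨁′ t ts

  InNPForm : {X : Set} → Term X → Set
  InNPForm t = Σ (List⁺ _) λ ts → All ⊕Free (Data.List.NonEmpty.toList ts) × (t ≡ ⨁ ts)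

-- The axiom (x ⊕ y) +ₚ z = (x +ₚ z) ⊕ (y +ₚ z), together with x +ₚ y = y +₁₋ₚ x for the
-- right argument, lets every ⊕ be pushed above every +ₚ.  So a term is normalised bottom-up:
-- the n-p form of (s₁ ⊕ … ⊕ sₘ) +ₚ (t₁ ⊕ … ⊕ tₙ) is the ⊕ of all sᵢ +ₚ tⱼ.
module Submission where

open import Defs
open import Data.Product using (Σ; _×_; _,_)
open import Data.List using (List; []; _∷_)
open import Data.List.NonEmpty using (List⁺; _∷_; toList; map; _⁺++⁺_)
open import Data.List.Relation.Unary.All using (All; []; _∷_)
import Data.List.Relation.Unary.All as All
open import Data.List.Relation.Unary.All.Properties using (++⁺; map⁺)
open import Relation.Binary.Bundles using (Setoid)
import Relation.Binary.PropositionalEquality as ≡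
import Relation.Binary.Reasoning.Setoid as SetoidReasoning

module _ (L : ProbLabels) {X : Set} where
  open ProbLabels L

  =E-setoid : Setoid _ _
  =E-setoid = record
    { Carrier       = Term L X
    ; _≈_           = _=E_ L
    ; isEquivalence = record { refl = refl ; sym = sym ; trans = trans }
    }

  open SetoidReasoning =E-setoid

  +-distribˡ-⊕ : ∀ p (s y z : Term L X) →
                 _=E_ L (s +[ p ] (y ⊕ z)) ((s +[ p ] y) ⊕ (s +[ p ] z))
  +-distribˡ-⊕ p s y z = begin
    s +[ p ] (y ⊕ z)                         ≈⟨ +-comm _ _ _ ⟩
    (y ⊕ z) +[ compl p ] s                   ≈⟨ distr _ _ _ _ ⟩
    (y +[ compl p ] s) ⊕ (z +[ compl p ] s)  ≈⟨ cong-⊕ (sym (+-comm _ _ _)) (sym (+-comm _ _ _)) ⟩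
    (s +[ p ] y) ⊕ (s +[ p ] z)              ∎

  ⨁-⁺++⁺ : (xs ys : List⁺ (Term L X)) → _=E_ L (⨁ L xs ⊕ ⨁ L ys) (⨁ L (xs ⁺++⁺ ys))
  ⨁-⁺++⁺ (x ∷ xs) ys = go x xs
    where
    go : ∀ x xs → _=E_ L (⨁ L (x ∷ xs) ⊕ ⨁ L ys) (⨁ L ((x ∷ xs) ⁺++⁺ ys))
    go x []        = refl
    go x (x′ ∷ xs) = trans (⊕-assoc _ _ _) (cong-⊕ refl (go x′ xs))

  ⨁-+ˡ : ∀ p s (ys : List⁺ (Term L X)) →
         _=E_ L (s +[ p ] ⨁ L ys) (⨁ L (map (s +[ p ]_) ys))
  ⨁-+ˡ p s (y ∷ ys) = go y ys
    where
    go : ∀ y ys → _=E_ L (s +[ p ] ⨁ L (y ∷ ys)) (⨁ L (map (s +[ p ]_) (y ∷ ys)))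
    go y []        = refl
    go y (y′ ∷ ys) = trans (+-distribˡ-⊕ p s _ _) (cong-⊕ refl (go y′ ys))

  _+ⁿᵖ[_]_ : List⁺ (Term L X) → Prob → List⁺ (Term L X) → List⁺ (Term L X)
  (x ∷ xs) +ⁿᵖ[ p ] ys = rows x xs
    where
    rows : Term L X → List (Term L X) → List⁺ (Term L X)
    rows x []        = map (x +[ p ]_) ys
    rows x (x′ ∷ xs) = map (x +[ p ]_) ys ⁺++⁺ rows x′ xs

  ⨁-+ⁿᵖ : ∀ p (xs ys : List⁺ (Term L X)) →
          _=E_ L (⨁ L xs +[ p ] ⨁ L ys) (⨁ L (xs +ⁿᵖ[ p ] ys))
  ⨁-+ⁿᵖ p (x ∷ xs) (y ∷ ys) = go x xs
    where
    go : ∀ x xs → _=E_ L (⨁ L (x ∷ xs) +[ p ] ⨁ L (y ∷ ys)) (⨁ L ((x ∷ xs) +ⁿᵖ[ p ] (y ∷ ys)))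
    go x []        = ⨁-+ˡ p x (y ∷ ys)
    go x (x′ ∷ xs) = begin
      (x ⊕ ⨁ L (x′ ∷ xs)) +[ p ] ⨁ L (y ∷ ys)
        ≈⟨ distr _ _ _ _ ⟩
      (x +[ p ] ⨁ L (y ∷ ys)) ⊕ (⨁ L (x′ ∷ xs) +[ p ] ⨁ L (y ∷ ys))
        ≈⟨ cong-⊕ (⨁-+ˡ p x (y ∷ ys)) (go x′ xs) ⟩
      ⨁ L (map (x +[ p ]_) (y ∷ ys)) ⊕ ⨁ L ((x′ ∷ xs) +ⁿᵖ[ p ] (y ∷ ys))
        ≈⟨ ⨁-⁺++⁺ (map (x +[ p ]_) (y ∷ ys)) _ ⟩
      ⨁ L ((x ∷ x′ ∷ xs) +ⁿᵖ[ p ] (y ∷ ys))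
        ∎

  ⊕Free-+ⁿᵖ : ∀ p (xs ys : List⁺ (Term L X)) →
              All (⊕Free L) (toList xs) → All (⊕Free L) (toList ys) →
              All (⊕Free L) (toList (xs +ⁿᵖ[ p ] ys))
  ⊕Free-+ⁿᵖ p (x ∷ xs) ys fxs fys = go x xs fxs
    where
    go : ∀ x xs → All (⊕Free L) (x ∷ xs) → All (⊕Free L) (toList ((x ∷ xs) +ⁿᵖ[ p ] ys))
    go x []        (fx ∷ [])  = map⁺ (All.map (prob p fx) fys)
    go x (x′ ∷ xs) (fx ∷ fxs) = ++⁺ (map⁺ (All.map (prob p fx) fys)) (go x′ xs fxs)

  toNP : Term L X → List⁺ (Term L X)
  toNP (var x)      = var x ∷ []
  toNP (s ⊕ t)      = toNP s ⁺++⁺ toNP t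
  toNP (s +[ p ] t) = toNP s +ⁿᵖ[ p ] toNP t

  toNP-⊕Free : ∀ t → All (⊕Free L) (toList (toNP t))
  toNP-⊕Free (var x)      = var x ∷ []
  toNP-⊕Free (s ⊕ t)      = ++⁺ (toNP-⊕Free s) (toNP-⊕Free t)
  toNP-⊕Free (s +[ p ] t) = ⊕Free-+ⁿᵖ p (toNP s) (toNP t) (toNP-⊕Free s) (toNP-⊕Free t)

  toNP-sound : ∀ t → _=E_ L t (⨁ L (toNP t))
  toNP-sound (var x)      = refl
  toNP-sound (s ⊕ t)      = trans (cong-⊕ (toNP-sound s) (toNP-sound t)) (⨁-⁺++⁺ (toNP s) (toNP t))
  toNP-sound (s +[ p ] t) = trans (cong-+ p (toNP-sound s) (toNP-sound t)) (⨁-+ⁿᵖ p (toNP s) (toNP t))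

proposition2 : (L : ProbLabels) (X : Set) (t : Term L X) →
    Σ (Term L X) λ t' → InNPForm L t' × _=E_ L t t'
proposition2 L X t = ⨁ L (toNP L t) , (toNP L t , toNP-⊕Free L t , ≡.refl) , toNP-sound L t
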